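{- Let $S=\{u_1,\dots,u_n\}$ be a finite set and $D=\{d_1,\dots,d_m\}$ a collection of subsets of $S$, and let $G=G(D,S)$ be the graph defined below. If $H$ is any graph with $H^2=G$, then there exists a partition of $S$ into two disjoint subsets $S_1$ and $S_2$ such that each subset in $D$ intersects both $S_1$ and $S_2$.
   Context: All graphs are finite, undirected and simple. For a graph $H$, $H^2$ is the graph on the same vertex set in which two distinct vertices are adjacent iff their distance in $H$ is at most $2$. The graph $G=G(D,S)$ has vertices $U_i$ ($1\le i\le n$), $D_j,D_j^1,D_j^2,D_j^3$ ($1\le j\le m$), and five further vertices $S_1,S_1',S_2,S_2',X$ (as vertex names, distinct from the sets of the partition). Its edges are exactly: for each $j$: $D_j^3D_j^2$, $D_j^3D_j^1$, $D_j^2D_j^1$, $D_j^2D_j$, $D_j^1D_j$, and $D_j^1U_i$ for every $i$ with $u_i\in d_j$; for each $j$: $D_jS_1$, $D_jS_1'$, $D_jS_2$, $D_jS_2'$, $D_jX$, $D_jU_i$ for all $i$, and $D_jD_k$ for every $k\ne j$ with $d_j\cap d_k\ne\emptyset$; for each $i$: $U_iX$, $U_iS_1$, $U_iS_2$, $U_iS_1'$, $U_iS_2'$, and $U_iU_{i'}$ for all $i'\ne i$; and finally $S_1X$, $S_1S_1'$, $S_1S_2'$, $S_2X$, $S_2S_1'$, $S_2S_2'$, $S_1'X$, $S_2'X$. -}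

module Defs where

open import Data.Nat using (ℕ)
open import Data.Fin using (Fin)
open import Data.Fin.Subset using (Subset; _∈_)
open import Data.Bool using (Bool; true; false)
open import Data.Product using (Σ; _×_; _,_)
open import Data.Sum using (_⊎_)
open import Relation.Binary.PropositionalEquality using (_≡_; _≢_)
open import Function.Bundles using (_⇔_)

data V (n m : ℕ) : Set where
  U  : Fin n → V n m
  Dv : Fin m → V n m
  D1 : Fin m → V n m
  D2 : Fin m → V n m
  D3 : Fin m → V n m
  S₁ S₁' S₂ S₂' X : V n m

record Graph (A : Set) : Set where
  field
    adj   : A → A → Bool
    sym   : ∀ a b → adj a b ≡ adj b a
    irrefl : ∀ a → adj a a ≡ false
open Graph public

Sq : {A : Set} → Graph A → A → A → Set
Sq {A} H a b = a ≢ b × (adj H a b ≡ true ⊎ Σ A (λ c → adj H a c ≡ true × adj H c b ≡ true))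

-- The listed edges of G(D,S) (one orientation each); d j is the subset d_j ⊆ S.
data GE {n m : ℕ} (d : Fin m → Subset n) : V n m → V n m → Set where
  e32  : ∀ j → GE d (D3 j) (D2 j)
  e31  : ∀ j → GE d (D3 j) (D1 j)
  e21  : ∀ j → GE d (D2 j) (D1 j)
  e2D  : ∀ j → GE d (D2 j) (Dv j)
  e1D  : ∀ j → GE d (D1 j) (Dv j)
  e1U  : ∀ j i → i ∈ d j → GE d (D1 j) (U i)
  eDS₁  : ∀ j → GE d (Dv j) S₁
  eDS₁' : ∀ j → GE d (Dv j) S₁'
  eDS₂  : ∀ j → GE d (Dv j) S₂
  eDS₂' : ∀ j → GE d (Dv j) S₂'
  eDX   : ∀ j → GE d (Dv j) X
  eDU   : ∀ j i → GE d (Dv j) (U i)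
  eDD   : ∀ j k → j ≢ k → (i : Fin n) → i ∈ d j → i ∈ d k → GE d (Dv j) (Dv k)
  eUX   : ∀ i → GE d (U i) X
  eUS₁  : ∀ i → GE d (U i) S₁
  eUS₂  : ∀ i → GE d (U i) S₂
  eUS₁' : ∀ i → GE d (U i) S₁'
  eUS₂' : ∀ i → GE d (U i) S₂'
  eUU   : ∀ i i' → i ≢ i' → GE d (U i) (U i')
  eS₁X   : GE d S₁ X
  eS₁S₁' : GE d S₁ S₁'
  eS₁S₂' : GE d S₁ S₂'
  eS₂X   : GE d S₂ X
  eS₂S₁' : GE d S₂ S₁'
  eS₂S₂' : GE d S₂ S₂'
  eS₁'X  : GE d S₁' X
  eS₂'X  : GE d S₂' X

GAdj : {n m : ℕ} → (Fin m → Subset n) → V n m → V n m → Set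
GAdj d a b = GE d a b ⊎ GE d b a

SquareIs : {n m : ℕ} → Graph (V n m) → (Fin m → Subset n) → Set
SquareIs H d = ∀ a b → Sq H a b ⇔ GAdj d a b

-- A partition of S into S₁ = {i | c i = true}, S₂ = {i | c i = false}
-- such that every d_j meets both parts.
Splits : {n m : ℕ} → (Fin m → Subset n) → (Fin n → Bool) → Set
Splits {n} d c = ∀ j → Σ (Fin n) (λ i → i ∈ d j × c i ≡ true) × Σ (Fin n) (λ i → i ∈ d j × c i ≡ false)

-- In a square root H of G(D,S), the triangle D³ⱼ D²ⱼ D¹ⱼ hanging off Dⱼ is rigid:
-- D³ⱼ, whose only G-neighbours are D²ⱼ and D¹ⱼ, is H-adjacent to one of them, and
-- the other must then be H-adjacent to Dⱼ. This is impossible for D²ⱼ, so D¹ⱼ ∼ Dⱼ.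
-- A vertex T ∈ {S₁, S₂} is at G-distance one from Dⱼ but not from D¹ⱼ, so the
-- H-path Dⱼ ∼ w ∼ T passes through a common G-neighbour w of D¹ⱼ and T, and the
-- only candidates are the Uᵢ with uᵢ ∈ dⱼ. Colouring uᵢ by whether Uᵢ ∼ S₁ therefore
-- splits every dⱼ: an element with Uᵢ ∼ S₂ cannot also have Uᵢ ∼ S₁, as S₁ and S₂
-- are not adjacent in G.
module Submission where

open import Defs
open import Data.Nat using (ℕ)
open import Data.Fin using (Fin; zero; suc) renaming (_≟_ to _≟ᶠ_)
open import Data.Fin.Subset using (Subset; _∈_)
open import Data.Bool using (Bool; true; false)
open import Data.Product using (Σ; ∃-syntax; _×_; _,_; proj₁; proj₂)
open import Data.Sum using (_⊎_; inj₁; inj₂; swap)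
open import Data.Sum.Properties using (≡-dec)
open import Data.Empty using (⊥-elim)
open import Relation.Nullary using (¬_; yes; no)
open import Relation.Nullary.Decidable using (map′)
open import Relation.Binary.Definitions using (DecidableEquality)
open import Relation.Binary.PropositionalEquality
  using (_≡_; _≢_; refl; trans; cong) renaming (sym to ≡-sym)
open import Function.Bundles using (_⇔_; Equivalence)

module SquareRoot {A : Set} (_≟_ : DecidableEquality A) (H : Graph A)
                  (G : A → A → Set) (H²≡G : ∀ a b → Sq H a b ⇔ G a b) where

  infix 4 _∼_
  _∼_ : A → A → Set
  a ∼ b = adj H a b ≡ true

  ∼-irrefl : ∀ {a b} → a ∼ b → a ≢ b
  ∼-irrefl {a} a∼a refl with trans (≡-sym a∼a) (irrefl H a)
  ... | ()

  ∼-sym : ∀ {a b} → a ∼ b → b ∼ a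
  ∼-sym {a} {b} a∼b = trans (≡-sym (Graph.sym H a b)) a∼b

  ∼⇒G : ∀ {a b} → a ∼ b → G a b
  ∼⇒G a∼b = Equivalence.to (H²≡G _ _) (∼-irrefl a∼b , inj₁ a∼b)

  ∼∼⇒G : ∀ {a b c} → a ≢ b → a ∼ c → c ∼ b → G a b
  ∼∼⇒G a≢b a∼c c∼b = Equivalence.to (H²≡G _ _) (a≢b , inj₂ (_ , a∼c , c∼b))

  G-irrefl : ∀ {a} → ¬ G a a
  G-irrefl Gaa = proj₁ (Equivalence.from (H²≡G _ _) Gaa) refl

  G⇒∼⊎∼∼ : ∀ {a b} → G a b → a ∼ b ⊎ ∃[ c ] a ∼ c × c ∼ b
  G⇒∼⊎∼∼ Gab = proj₂ (Equivalence.from (H²≡G _ _) Gab)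

  NeighboursIn : A → A → A → Set
  NeighboursIn t x y = ∀ {z} → G t z → z ≡ x ⊎ z ≡ y

  module _ {t x y : A} (N[t] : NeighboursIn t x y) where

    pendant-attached : G t x → t ∼ x ⊎ t ∼ y
    pendant-attached Gtx with G⇒∼⊎∼∼ Gtx
    ... | inj₁ t∼x = inj₁ t∼x
    ... | inj₂ (c , t∼c , c∼x) with N[t] (∼⇒G t∼c)
    ...   | inj₁ refl = inj₁ t∼c
    ...   | inj₂ refl = inj₂ t∼c

    pendant-closed : ∀ {c} → t ∼ x → x ∼ c → c ≡ t ⊎ c ≡ y
    pendant-closed {c} t∼x x∼c with c ≟ t
    ... | yes c≡t = inj₁ c≡t
    ... | no c≢t with N[t] (∼∼⇒G (λ t≡c → c≢t (≡-sym t≡c)) t∼x x∼c)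
    ...   | inj₁ refl = ⊥-elim (∼-irrefl x∼c refl)
    ...   | inj₂ c≡y = inj₂ c≡y

    pendant-far : ∀ {v} → G x v → v ≢ y → ¬ G t v
    pendant-far Gxv v≢y Gtv with N[t] Gtv
    ... | inj₁ refl = G-irrefl Gxv
    ... | inj₂ v≡y = v≢y v≡y

    pendant-detour : ∀ {v} → t ∼ x → G x v → v ≢ t → v ≢ y → y ∼ v
    pendant-detour t∼x Gxv v≢t v≢y with G⇒∼⊎∼∼ Gxv
    ... | inj₁ x∼v with pendant-closed t∼x x∼v
    ...   | inj₁ v≡t = ⊥-elim (v≢t v≡t)
    ...   | inj₂ v≡y = ⊥-elim (v≢y v≡y)
    pendant-detour t∼x Gxv v≢t v≢y | inj₂ (c , x∼c , c∼v) with pendant-closed t∼x x∼c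
    ...   | inj₁ refl = ⊥-elim (pendant-far Gxv v≢y (∼⇒G c∼v))
    ...   | inj₂ refl = c∼v

  ∼-through : ∀ {y v T} → y ∼ v → G v T → y ≢ T → ¬ G y T →
              ∃[ w ] G y w × v ∼ w × w ∼ T
  ∼-through {y} y∼v GvT y≢T ¬GyT with G⇒∼⊎∼∼ GvT
  ... | inj₁ v∼T = ⊥-elim (¬GyT (∼∼⇒G y≢T y∼v v∼T))
  ... | inj₂ (w , v∼w , w∼T) with w ≟ y
  ...   | yes refl = ⊥-elim (¬GyT (∼⇒G w∼T))
  ...   | no w≢y = w , ∼∼⇒G (λ y≡w → w≢y (≡-sym y≡w)) y∼v v∼w , v∼w , w∼T

module _ {n m : ℕ} where

  private
    Code : Set
    Code = Fin n ⊎ Fin m ⊎ Fin m ⊎ Fin m ⊎ Fin m ⊎ Fin 5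

    encode : V n m → Code
    encode (U i)  = inj₁ i
    encode (Dv j) = inj₂ (inj₁ j)
    encode (D1 j) = inj₂ (inj₂ (inj₁ j))
    encode (D2 j) = inj₂ (inj₂ (inj₂ (inj₁ j)))
    encode (D3 j) = inj₂ (inj₂ (inj₂ (inj₂ (inj₁ j))))
    encode S₁     = inj₂ (inj₂ (inj₂ (inj₂ (inj₂ zero))))
    encode S₁'    = inj₂ (inj₂ (inj₂ (inj₂ (inj₂ (suc zero)))))
    encode S₂     = inj₂ (inj₂ (inj₂ (inj₂ (inj₂ (suc (suc zero))))))
    encode S₂'    = inj₂ (inj₂ (inj₂ (inj₂ (inj₂ (suc (suc (suc zero)))))))
    encode X      = inj₂ (inj₂ (inj₂ (inj₂ (inj₂ (suc (suc (suc (suc zero))))))))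

    decode : Code → V n m
    decode (inj₁ i) = U i
    decode (inj₂ (inj₁ j)) = Dv j
    decode (inj₂ (inj₂ (inj₁ j))) = D1 j
    decode (inj₂ (inj₂ (inj₂ (inj₁ j)))) = D2 j
    decode (inj₂ (inj₂ (inj₂ (inj₂ (inj₁ j))))) = D3 j
    decode (inj₂ (inj₂ (inj₂ (inj₂ (inj₂ zero))))) = S₁
    decode (inj₂ (inj₂ (inj₂ (inj₂ (inj₂ (suc zero)))))) = S₁'
    decode (inj₂ (inj₂ (inj₂ (inj₂ (inj₂ (suc (suc zero))))))) = S₂
    decode (inj₂ (inj₂ (inj₂ (inj₂ (inj₂ (suc (suc (suc zero)))))))) = S₂'
    decode (inj₂ (inj₂ (inj₂ (inj₂ (inj₂ (suc (suc (suc (suc zero))))))))) = X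

    decode-encode : ∀ v → decode (encode v) ≡ v
    decode-encode (U _)  = refl
    decode-encode (Dv _) = refl
    decode-encode (D1 _) = refl
    decode-encode (D2 _) = refl
    decode-encode (D3 _) = refl
    decode-encode S₁     = refl
    decode-encode S₁'    = refl
    decode-encode S₂     = refl
    decode-encode S₂'    = refl
    decode-encode X      = refl

    _≟ᶜ_ : DecidableEquality Code
    _≟ᶜ_ = ≡-dec _≟ᶠ_ (≡-dec _≟ᶠ_ (≡-dec _≟ᶠ_ (≡-dec _≟ᶠ_ (≡-dec _≟ᶠ_ _≟ᶠ_))))

  _≟ᵛ_ : DecidableEquality (V n m)
  v ≟ᵛ w = map′ encode-injective (cong encode) (encode v ≟ᶜ encode w)
    where
    encode-injective : encode v ≡ encode w → v ≡ w
    encode-injective e =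
      trans (≡-sym (decode-encode v)) (trans (cong decode e) (decode-encode w))

module Gadget {n m : ℕ} (d : Fin m → Subset n) where

  D3-neighbours : ∀ {j z} → GAdj d (D3 j) z → z ≡ D2 j ⊎ z ≡ D1 j
  D3-neighbours (inj₁ (e32 _)) = inj₁ refl
  D3-neighbours (inj₁ (e31 _)) = inj₂ refl
  D3-neighbours (inj₂ ())

  D2-neighbours : ∀ {j z} → GAdj d (D2 j) z → z ≡ D3 j ⊎ z ≡ D1 j ⊎ z ≡ Dv j
  D2-neighbours (inj₁ (e21 _)) = inj₂ (inj₁ refl)
  D2-neighbours (inj₁ (e2D _)) = inj₂ (inj₂ refl)
  D2-neighbours (inj₂ (e32 _)) = inj₁ refl

  D1-neighbours : ∀ {j z} → GAdj d (D1 j) z →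
    z ≡ D3 j ⊎ z ≡ D2 j ⊎ z ≡ Dv j ⊎ ∃[ i ] i ∈ d j × z ≡ U i
  D1-neighbours (inj₁ (e1D _)) = inj₂ (inj₂ (inj₁ refl))
  D1-neighbours (inj₁ (e1U _ i i∈dj)) = inj₂ (inj₂ (inj₂ (i , i∈dj , refl)))
  D1-neighbours (inj₂ (e31 _)) = inj₁ refl
  D1-neighbours (inj₂ (e21 _)) = inj₂ (inj₁ refl)

  module _ (H : Graph (V n m)) (H²≡G : SquareIs H d) where

    open SquareRoot _≟ᵛ_ H (GAdj d) H²≡G

    gadget-reaches : ∀ j {T} → GAdj d (Dv j) T → D1 j ≢ T → D2 j ≢ T →
      ¬ GAdj d (D1 j) T → ¬ GAdj d (D2 j) T → ¬ GAdj d (D3 j) T →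
      ∃[ i ] i ∈ d j × U i ∼ T
    gadget-reaches j GvT D1≢T D2≢T ¬G1T ¬G2T ¬G3T
      with pendant-attached D3-neighbours (inj₁ (e32 j))
    ... | inj₁ D3∼D2
      with ∼-through (pendant-detour D3-neighbours D3∼D2 (inj₁ (e2D j)) (λ ()) (λ ()))
                     GvT D1≢T ¬G1T
    ...   | w , G1w , v∼w , w∼T with D1-neighbours G1w
    ...     | inj₁ refl = ⊥-elim (¬G3T (∼⇒G w∼T))
    ...     | inj₂ (inj₁ refl) = ⊥-elim (¬G2T (∼⇒G w∼T))
    ...     | inj₂ (inj₂ (inj₁ refl)) = ⊥-elim (∼-irrefl v∼w refl)
    ...     | inj₂ (inj₂ (inj₂ (i , i∈dj , refl))) = i , i∈dj , w∼T
    gadget-reaches j GvT D1≢T D2≢T ¬G1T ¬G2T ¬G3T | inj₂ D3∼D1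
      with ∼-through (pendant-detour (λ G3z → swap (D3-neighbours G3z)) D3∼D1 (inj₁ (e1D j)) (λ ()) (λ ()))
                     GvT D2≢T ¬G2T
    ...   | w , G2w , v∼w , w∼T with D2-neighbours G2w
    ...     | inj₁ refl = ⊥-elim (¬G3T (∼⇒G w∼T))
    ...     | inj₂ (inj₁ refl) = ⊥-elim (¬G1T (∼⇒G w∼T))
    ...     | inj₂ (inj₂ refl) = ⊥-elim (∼-irrefl v∼w refl)

lemma4p3 : (n m : ℕ) (d : Fin m → Subset n) (H : Graph (V n m)) →
    SquareIs H d → Σ (Fin n → Bool) (λ c → Splits d c)
lemma4p3 n m d H H²≡G = colour , splits
  where
  open Gadget d
  open SquareRoot _≟ᵛ_ H (GAdj d) H²≡G

  colour : Fin n → Bool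
  colour i = adj H (U i) S₁

  splits : Splits d colour
  splits j = S₁-reached , coloured-false S₂-reached
    where
    S₁-reached : ∃[ i ] i ∈ d j × U i ∼ S₁
    S₁-reached = gadget-reaches H H²≡G j (inj₁ (eDS₁ j)) (λ ()) (λ ())
      (λ { (inj₁ ()) ; (inj₂ ()) }) (λ { (inj₁ ()) ; (inj₂ ()) }) (λ { (inj₁ ()) ; (inj₂ ()) })
    S₂-reached : ∃[ i ] i ∈ d j × U i ∼ S₂
    S₂-reached = gadget-reaches H H²≡G j (inj₁ (eDS₂ j)) (λ ()) (λ ())
      (λ { (inj₁ ()) ; (inj₂ ()) }) (λ { (inj₁ ()) ; (inj₂ ()) }) (λ { (inj₁ ()) ; (inj₂ ()) })
    coloured-false : ∃[ i ] i ∈ d j × U i ∼ S₂ → ∃[ i ] i ∈ d j × colour i ≡ false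
    coloured-false (i , i∈dj , Ui∼S₂) with adj H (U i) S₁ in Ui∼S₁
    ... | false = i , i∈dj , Ui∼S₁
    ... | true with ∼∼⇒G (λ ()) (∼-sym Ui∼S₁) Ui∼S₂
    ...   | inj₁ ()
    ...   | inj₂ ()
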